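{- Let $\mathcal{C}$ and $\mathcal{D}$ be two different splittings of a $D$-set $\Omega$. Then there is a sector $D_0$ of $\mathcal{D}$ such that all but at most one of the sectors of $\mathcal{C}$ are contained in $D_0$.
   Context: A $D$-set is a set $\Omega$ with a quaternary relation $D$, written $D(wx;yz)$, such that for all $w,x,y,z\in\Omega$: (D1) $D(wx;yz)\to (D(xw;yz)\wedge D(yz;wx))$; (D2) $D(wx;yz)\to\neg D(wy;xz)$; (D3) $D(wx;yz)\to\forall v\,(D(vx;yz)\vee D(wx;yv))$; (D4) $(w\neq y\wedge x\neq y)\to D(wx;yy)$. A splitting of $\Omega$ is a partition of $\Omega$ into at least two parts (sectors) such that (i) if $a,b$ lie in a part $\Sigma$ and $c,d\in\Omega\setminus\Sigma$ then $D(ab;cd)$, and (ii) if $a,b,c,d$ lie in four distinct parts then $\neg D(ab;cd)$. -}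

module Defs where

open import Data.Sum using (_⊎_)
open import Data.Product using (Σ; ∃; ∃-syntax; _×_; _,_)
open import Relation.Nullary using (¬_)
open import Relation.Binary.PropositionalEquality using (_≡_; _≢_)
open import Relation.Binary.Structures using (IsEquivalence)

-- D w x y z  stands for  D(wx;yz)
record IsDSet (Ω : Set) (D : Ω → Ω → Ω → Ω → Set) : Set where
  field
    D1 : ∀ {w x y z} → D w x y z → D x w y z × D y z w x
    D2 : ∀ {w x y z} → D w x y z → ¬ D w y x z
    D3 : ∀ {w x y z} → D w x y z → ∀ v → (D v x y z ⊎ D w x y v)
    D4 : ∀ {w x y} → w ≢ y → x ≢ y → D w x y y

-- A partition of Ω is represented by its "same part" equivalence relation _~_;
-- the parts (sectors) are the equivalence classes.
record IsSplitting (Ω : Set) (D : Ω → Ω → Ω → Ω → Set) (_~_ : Ω → Ω → Set) : Set where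
  field
    equiv      : IsEquivalence _~_
    twoParts   : ∃[ x ] ∃[ y ] ¬ (x ~ y)
    sectorCond : ∀ {a b c d} → a ~ b → ¬ (a ~ c) → ¬ (a ~ d) → D a b c d
    distinctCond : ∀ {a b c d} → ¬ (a ~ b) → ¬ (a ~ c) → ¬ (a ~ d)
                   → ¬ (b ~ c) → ¬ (b ~ d) → ¬ (c ~ d) → ¬ D a b c d

SamePartition : {Ω : Set} → (Ω → Ω → Set) → (Ω → Ω → Set) → Set
SamePartition {Ω} R S = ∀ (x y : Ω) → (R x y → S x y) × (S x y → R x y)

-- If some pair lies in one 𝒞-sector but in different 𝒟-sectors, that 𝒞-sector Σ is the
-- exception: for x, y outside Σ the splitting 𝒞 gives D(pq;xy), and in the splitting 𝒟 a
-- D-relation always joins one of its two pairs, so x and y share a 𝒟-sector.  Otherwise 𝒞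
-- refines 𝒟, and since 𝒞 ≠ 𝒟 some 𝒟-sector contains two 𝒞-sectors, of p and q; choosing z
-- outside that 𝒟-sector, every x outside the 𝒞-sector of z lies in the 𝒟-sector of p, for
-- else p, q, x, z would lie in four distinct 𝒞-sectors although 𝒟 gives D(pq;xz).
module Submission where

open import Defs
open import Data.Product using (∃; ∃-syntax; _×_; _,_; proj₁; proj₂)
open import Data.Sum using (_⊎_; inj₁; inj₂)
open import Relation.Nullary using (¬_; yes; no)
open import Data.Empty using (⊥; ⊥-elim)
open import Relation.Binary.Structures using (IsEquivalence)
open import Axiom.ExcludedMiddle using (ExcludedMiddle)
open import Axiom.DoubleNegationElimination using (em⇒dne)
open import Level using (0ℓ)

module _ {Ω : Set} {D : Ω → Ω → Ω → Ω → Set} (ds : IsDSet Ω D) where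
  open IsDSet ds

  D-swapʳ : ∀ {a b c d} → D a b c d → D a b d c
  D-swapʳ h = proj₂ (D1 (proj₁ (D1 (proj₂ (D1 h)))))

  D-swapˡ : ∀ {a b c d} → D a b c d → D b a c d
  D-swapˡ h = proj₁ (D1 h)

  module _ {_~_ : Ω → Ω → Set} (sp : IsSplitting Ω D _~_) where
    open IsSplitting sp
    open IsEquivalence equiv

    ≁-sym : ∀ {a b} → ¬ a ~ b → ¬ b ~ a
    ≁-sym a≁b b~a = a≁b (sym b~a)

    D-apartˡ : ∀ {a b c d} → D a b c d → ¬ a ~ b → ¬ c ~ d → ¬ a ~ c
    D-apartˡ h a≁b c≁d a~c =
      D2 h (sectorCond a~c a≁b (λ a~d → c≁d (trans (sym a~c) a~d)))

    D-not-across : ∀ {a b c d} → D a b c d → ¬ a ~ b → ¬ c ~ d → ⊥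
    D-not-across h a≁b c≁d =
      distinctCond a≁b (D-apartˡ h a≁b c≁d) (D-apartˡ (D-swapʳ h) a≁b (≁-sym c≁d))
                   (D-apartˡ (D-swapˡ h) (≁-sym a≁b) c≁d)
                   (D-apartˡ (D-swapˡ (D-swapʳ h)) (≁-sym a≁b) (≁-sym c≁d))
                   c≁d h

    module _ (em : ExcludedMiddle 0ℓ) where

      D-joins-a-pair : ∀ {a b c d} → D a b c d → a ~ b ⊎ c ~ d
      D-joins-a-pair {a} {b} {c} {d} h with em {a ~ b} | em {c ~ d}
      ... | yes a~b | _       = inj₁ a~b
      ... | no _    | yes c~d = inj₂ c~d
      ... | no a≁b  | no c≁d  = ⊥-elim (D-not-across h a≁b c≁d)

      outside-sector : ∀ p → ∃[ x ] ¬ x ~ p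
      outside-sector p with twoParts
      ... | a , b , a≁b with em {a ~ p}
      ...   | no a≁p  = a , a≁p
      ...   | yes a~p = b , λ b~p → a≁b (trans a~p (sym b~p))

module _ {Ω : Set} {D : Ω → Ω → Ω → Ω → Set} (ds : IsDSet Ω D)
         {C∼ D∼ : Ω → Ω → Set} (cs : IsSplitting Ω D C∼) (dsp : IsSplitting Ω D D∼) where
  private
    module 𝒞 = IsSplitting cs
    module 𝒟 = IsSplitting dsp
    module 𝒟E = IsEquivalence 𝒟.equiv

  outside-split-sector-is-one-sector : ExcludedMiddle 0ℓ → ∀ {p q} → C∼ p q → ¬ D∼ p q →
    ∀ {x y} → ¬ C∼ x p → ¬ C∼ y p → D∼ x y
  outside-split-sector-is-one-sector em p~q p≁q x≁p y≁p
    with D-joins-a-pair ds dsp em (𝒞.sectorCond p~q (≁-sym ds cs x≁p) (≁-sym ds cs y≁p))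
  ... | inj₁ p~q′ = ⊥-elim (p≁q p~q′)
  ... | inj₂ x~y  = x~y

  refinement-merged-sector : ExcludedMiddle 0ℓ → (∀ {u v} → C∼ u v → D∼ u v) →
    ∀ {p q} → ¬ C∼ p q → D∼ p q → ∀ {z} → ¬ D∼ z p → ∀ {x} → ¬ C∼ x z → D∼ x p
  refinement-merged-sector em refines {p} {q} p≁q p~q {z} z≁p {x} x≁z = em⇒dne em λ x≁p →
    let ≁p : ∀ {u} → ¬ D∼ u p → ¬ C∼ p u
        ≁p u≁p p~u = u≁p (𝒟E.sym (refines p~u))
        ≁q : ∀ {u} → ¬ D∼ u p → ¬ C∼ q u
        ≁q u≁p q~u = u≁p (𝒟E.trans (𝒟E.sym (refines q~u)) (𝒟E.sym p~q))
    in 𝒞.distinctCond p≁q (≁p x≁p) (≁p z≁p) (≁q x≁p) (≁q z≁p) x≁z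
         (𝒟.sectorCond p~q (≁-sym ds dsp x≁p) (≁-sym ds dsp z≁p))

included-or-counterexample : ExcludedMiddle 0ℓ → {Ω : Set} (R S : Ω → Ω → Set) →
  (∀ {u v} → R u v → S u v) ⊎ ∃[ u ] ∃[ v ] (R u v × ¬ S u v)
included-or-counterexample em R S with em {∃[ u ] ∃[ v ] (R u v × ¬ S u v)}
... | yes counterexample = inj₂ counterexample
... | no none = inj₁ λ {u} {v} r → em⇒dne em λ ¬s → none (u , v , r , ¬s)

mainTheorem5 : ExcludedMiddle 0ℓ →
    (Ω : Set) (D : Ω → Ω → Ω → Ω → Set) → IsDSet Ω D →
    (C∼ D∼ : Ω → Ω → Set) → IsSplitting Ω D C∼ → IsSplitting Ω D D∼ →
    ¬ SamePartition C∼ D∼ →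
    ∃[ d₀ ] ∃[ e ] (∀ (x : Ω) → ¬ C∼ x e → D∼ x d₀)
mainTheorem5 em Ω D ds C∼ D∼ cs dsp C≠D
  with included-or-counterexample em C∼ D∼
... | inj₂ (p , q , p~q , p≁q) =
  let x₀ , x₀≁p = outside-sector ds cs em p
  in x₀ , p , λ x x≁p → outside-split-sector-is-one-sector ds cs dsp em p~q p≁q x≁p x₀≁p
... | inj₁ C⊆D with included-or-counterexample em D∼ C∼
...   | inj₂ (p , q , p~q , p≁q) =
  let z , z≁p = outside-sector ds dsp em p
  in p , z , λ x x≁z → refinement-merged-sector ds cs dsp em C⊆D p≁q p~q z≁p x≁z
...   | inj₁ D⊆C = ⊥-elim (C≠D λ x y → C⊆D , D⊆C)
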